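{- Let $G=(V,A)$ be a flow graph with start vertex $s$, let $F$ be a depth-first spanning tree of $G$ rooted at $s$ with vertices identified with their reverse-postorder numbers and with $f(u)$ the parent of $u$ in $F$, let $H$ be the loop nesting forest defined by $F$, and let $T$ be a rooted tree with the parent property. For $u\neq s$ let $(f'(u),u)$ be the derived arc (with respect to $T$) of $(f(u),u)$ (it is non-null). Then $T$ has the sibling property if and only if, for each $u\neq s$, either $f(u)=t(u)$, or there is an arc $(y,w)\in A$ with non-null derived arc $(y',w)$ such that $w$ is a descendant of $u$ in $H$, $y<u$, and $y'\neq f'(u)$.
   Context: A flow graph is a finite directed graph $G=(V,A)$ with start vertex $s$ such that every vertex is reachable from $s$; there are no arcs entering $s$. A vertex $v$ dominates $w$ if every path from $s$ to $w$ contains $v$. $F$ is the spanning tree produced by a depth-first search of $G$ from $s$; vertices are numbered in reverse postorder. Ancestors/descendants include the vertex itself. The head $h(v)$ of $v$ is the maximum proper ancestor $u$ of $v$ in $F$ such that there is a path from $v$ to $u$ containing only descendants of $u$ in $F$ (null if none); the loop nesting forest $H$ has parent function $h$. For a rooted tree $T$ with vertex set contained in $V$, $t(v)$ denotes the parent of $v$; $T$ has the parent property if for every arc $(x,y)\in A$, $t(y)$ is an ancestor of $x$ in $T$; $T$ has the sibling property if for all siblings $v,w$ in $T$, $v$ does not dominate $w$. For an arc $(v,w)\in A$, its derived arc is null if $w$ is an ancestor of $v$ in $T$, and otherwise is $(v',w)$, where $v'=v$ if $v=t(w)$, and otherwise $v'$ is the sibling of $w$ in $T$ that is an ancestor of $v$.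 -}

module Defs where

open import Data.Nat using (ℕ)
open import Data.Fin using (Fin; _<_; _≤_)
open import Data.Bool using (Bool; T)
open import Data.Product using (Σ; ∃; _×_; _,_)
open import Data.Sum using (_⊎_)
open import Data.Unit using (⊤)
open import Relation.Nullary using (¬_)
open import Relation.Binary.PropositionalEquality using (_≡_; _≢_)

Graph : ℕ → Set
Graph n = Fin n → Fin n → Bool

Arc : ∀ {n} → Graph n → Fin n → Fin n → Set
Arc G x y = T (G x y)

data WalkIn {n} (G : Graph n) (P : Fin n → Set) : Fin n → Fin n → Set where
  stop : ∀ {x} → P x → WalkIn G P x x
  step : ∀ {x y z} → P x → Arc G x y → WalkIn G P y z → WalkIn G P x z

Walk : ∀ {n} → Graph n → Fin n → Fin n → Set
Walk G = WalkIn G (λ _ → ⊤)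

data OnWalk {n} {G : Graph n} {P : Fin n → Set} (v : Fin n)
     : ∀ {x y} → WalkIn G P x y → Set where
  on-stop : ∀ {p : P v} → OnWalk v (stop p)
  on-head : ∀ {y z} {p : P v} {a : Arc G v y} {w : WalkIn G P y z} →
            OnWalk v (step p a w)
  on-tail : ∀ {x y z} {p : P x} {a : Arc G x y} {w : WalkIn G P y z} →
            OnWalk v w → OnWalk v (step p a w)

record IsFlowGraph {n} (G : Graph n) (s : Fin n) : Set where
  field
    reachable : ∀ v → Walk G s v
    noEntry   : ∀ v → ¬ Arc G v s

Dominates : ∀ {n} → Graph n → Fin n → Fin n → Fin n → Set
Dominates G s v w = (p : Walk G s w) → OnWalk v p

-- Rooted trees whose vertex set is a subset of V, given by a membership
-- predicate, a root and a parent function (value at the root and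
-- outside the tree is irrelevant).

record PTree (n : ℕ) : Set₁ where
  field
    InT  : Fin n → Set
    root : Fin n
    par  : Fin n → Fin n
open PTree public

data Anc {n} (T : PTree n) (u : Fin n) : Fin n → Set where
  anc-refl : InT T u → Anc T u u
  anc-step : ∀ {v} → InT T v → v ≢ root T → Anc T u (par T v) → Anc T u v

record IsRootedTree {n} (T : PTree n) : Set where
  field
    root∈  : InT T (root T)
    par∈   : ∀ v → InT T v → v ≢ root T → InT T (par T v)
    rooted : ∀ v → InT T v → Anc T (root T) v

ParentProperty : ∀ {n} → Graph n → PTree n → Set
ParentProperty G T =
  ∀ x y → Arc G x y → InT T y × y ≢ root T × Anc T (par T y) x

Siblings : ∀ {n} → PTree n → Fin n → Fin n → Set
Siblings T v w =
  v ≢ w × InT T v × InT T w × v ≢ root T × w ≢ root T × par T v ≡ par T w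

SiblingProperty : ∀ {n} → Graph n → Fin n → PTree n → Set
SiblingProperty G s T = ∀ v w → Siblings T v w → ¬ Dominates G s v w

-- DerivedArc T v w v' : the derived arc of (v,w) w.r.t. T is non-null and
-- equals (v',w).  (It is null iff w is an ancestor of v in T.)
DerivedArc : ∀ {n} → PTree n → Fin n → Fin n → Fin n → Set
DerivedArc T v w v' =
  ¬ Anc T w v ×
  ((v ≡ par T w × v' ≡ v) ⊎
   (v ≢ par T w × Siblings T v' w × Anc T v' v))

-- F is a spanning tree of G rooted at s whose arcs are arcs of G; the
-- numbering (the order of Fin n) is a preorder of F (parents before
-- children, the descendants of each vertex form an interval starting at
-- it), i.e. a reverse postorder for a suitable order of children; and F is
-- a DFS tree for it: every arc (v,w) of G has v < w or w an ancestor of v.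

record IsDFSTree {n} (G : Graph n) (s : Fin n) (F : PTree n) : Set where
  field
    tree      : IsRootedTree F
    rootF     : root F ≡ s
    spanning  : ∀ v → InT F v
    treeArcs  : ∀ v → v ≢ s → Arc G (par F v) v
    ancLe     : ∀ u v → Anc F u v → u ≤ v
    interval  : ∀ u v w → Anc F u w → u ≤ v → v ≤ w → Anc F u v
    dfsArcs   : ∀ v w → Arc G v w → v < w ⊎ Anc F w v

-- Loop nesting forest H.
-- IsHead G F v u : u = h(v), i.e. u is the maximum proper ancestor of v in
-- F such that there is a path from v to u containing only descendants of u.

HeadCand : ∀ {n} → Graph n → PTree n → Fin n → Fin n → Set
HeadCand G F v u = Anc F u v × u ≢ v × WalkIn G (λ x → Anc F u x) v u

IsHead : ∀ {n} → Graph n → PTree n → Fin n → Fin n → Set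
IsHead G F v u = HeadCand G F v u × (∀ u' → HeadCand G F v u' → u' ≤ u)

data DescH {n} (G : Graph n) (F : PTree n) (u : Fin n) : Fin n → Set where
  dh-refl : DescH G F u u
  dh-step : ∀ {w x} → IsHead G F w x → DescH G F u x → DescH G F u w

{-# OPTIONS --safe #-}
-- By the parent property every T-ancestor of w dominates w, and dominators are F-ancestors,
-- so ancestors in T precede their descendants in the numbering.
--
-- (⇒) If f(u) ≠ t(u), the derived arc of (f(u),u) starts at a sibling f′(u) of u, which by
-- the sibling property does not dominate u.  On a path from s to u avoiding f′(u), the last
-- arc (y,w) with y < u is followed only by vertices ≥ u, which by the DFS property lie below u
-- in F, so w is an H-descendant of u; the derived source y′ is a T-ancestor of y, hence
-- dominates y, hence differs from f′(u).
--
-- (⇐) By induction on u assume the sibling property below u.  Then dominators of vertices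
-- z < u are T-ancestors of z.  A sibling v of u dominating u dominates the whole H-subtree of u
-- and every source y < u of an arc (y,x) entering it, so v is a T-ancestor of y; this forces
-- t(x) = t(v) and the derived arc of (y,x) to start at v.  Applied to (f(u),u) as well, this
-- contradicts the condition at u.
module Submission where

open import Defs
open import Level using (0ℓ)
import Data.Nat as ℕ
import Data.Nat.Properties as ℕ
import Data.Nat.Induction as ℕ
open import Data.Fin using (Fin; _<_; _>_; _≤_)
open import Data.Fin.Properties using (_≟_; _<?_; any?; ≤-antisym; ≤-refl; <-cmp; <-trans; ≤∧≢⇒<; <⇒≢)
open import Data.Fin.Induction using (<-wellFounded; >-wellFounded)
import Data.Fin.Subset as Subset
open Subset using (Subset; ∣_∣; _-_; ⁅_⁆; _∈_)
open import Data.Fin.Subset.Properties using (_∈?_; ∈⊤; p─q⊆p; x∈p∧x≢y⇒x∈p-y; x∈p⇒∣p-x∣<∣p∣)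
open import Induction.WellFounded using (Acc; acc)
open import Data.Bool.Properties using (T?)
open import Data.Product using (Σ; ∃; _×_; _,_; proj₁; proj₂; map₂)
open import Data.Sum using (_⊎_; inj₁; inj₂)
open import Data.Unit using (tt)
open import Data.Empty using (⊥-elim)
open import Function using (_∘_; case_of_)
open import Relation.Nullary using (¬_; Dec; yes; no)
open import Relation.Nullary.Decidable using (_×-dec_; ¬?; map′)
open import Relation.Unary using (Pred; Decidable; _⊆_; _∩_)
open import Relation.Binary using (tri<; tri≈; tri>)
open import Relation.Binary.PropositionalEquality
  using (_≡_; _≢_; refl; sym; trans; subst; ≢-sym)
open import Function.Bundles using (_⇔_; mk⇔)

module _ {n} {G : Graph n} where

  source-P : ∀ {P x y} → WalkIn G P x y → P x
  source-P (stop p)     = p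
  source-P (step p _ _) = p

  OnWalk⇒P : ∀ {P x y z} (w : WalkIn G P x y) → OnWalk z w → P z
  OnWalk⇒P (stop p)     on-stop     = p
  OnWalk⇒P (step p _ _) on-head     = p
  OnWalk⇒P (step _ _ w) (on-tail o) = OnWalk⇒P w o

  WalkIn-map : ∀ {P Q : Pred (Fin n) 0ℓ} → P ⊆ Q → ∀ {x y} → WalkIn G P x y → WalkIn G Q x y
  WalkIn-map f (stop p)     = stop (f p)
  WalkIn-map f (step p a w) = step (f p) a (WalkIn-map f w)

  OnWalk-map⁻ : ∀ {P Q : Pred (Fin n) 0ℓ} (f : P ⊆ Q) {x y z} (w : WalkIn G P x y) →
                OnWalk z (WalkIn-map f w) → OnWalk z w
  OnWalk-map⁻ f (stop _)     on-stop     = on-stop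
  OnWalk-map⁻ f (step _ _ _) on-head     = on-head
  OnWalk-map⁻ f (step _ _ w) (on-tail o) = on-tail (OnWalk-map⁻ f w o)

  toWalk : ∀ {P x y} → WalkIn G P x y → Walk G x y
  toWalk = WalkIn-map (λ _ → tt)

  snoc : ∀ {P x y z} → WalkIn G P x y → Arc G y z → P z → WalkIn G P x z
  snoc (stop p)     a pz = step p a (stop pz)
  snoc (step p b w) a pz = step p b (snoc w a pz)

  OnWalk-snoc⁻ : ∀ {P x y z v} (w : WalkIn G P x y) (a : Arc G y z) (pz : P z) →
                 OnWalk v (snoc w a pz) → OnWalk v w ⊎ v ≡ z
  OnWalk-snoc⁻ (stop _)     a pz on-head               = inj₁ on-stop
  OnWalk-snoc⁻ (stop _)     a pz (on-tail on-stop)     = inj₂ refl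
  OnWalk-snoc⁻ (step _ _ w) a pz on-head               = inj₁ on-head
  OnWalk-snoc⁻ (step _ _ w) a pz (on-tail o) with OnWalk-snoc⁻ w a pz o
  ... | inj₁ o′  = inj₁ (on-tail o′)
  ... | inj₂ v≡z = inj₂ v≡z

  _++ʷ_ : ∀ {P x y z} → WalkIn G P x y → WalkIn G P y z → WalkIn G P x z
  stop _     ++ʷ w′ = w′
  step p a w ++ʷ w′ = step p a (w ++ʷ w′)

  prefix : ∀ {P x y v} (w : WalkIn G P x y) → OnWalk v w →
           Σ (WalkIn G P x v) λ q → ∀ {c} → OnWalk c q → OnWalk c w
  prefix (stop p)     on-stop     = stop p , λ o → o
  prefix (step p a w) on-head     = stop p , λ { on-stop → on-head }
  prefix (step p a w) (on-tail o) with prefix w o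
  ... | q , q⊆w = step p a q , λ { on-head → on-head ; (on-tail o′) → on-tail (q⊆w o′) }

  avoid : ∀ {P x y} v (w : WalkIn G P x y) → OnWalk v w ⊎ WalkIn G (_≢ v) x y
  avoid {x = x} v (stop _) with x ≟ v
  ... | yes refl = inj₁ on-stop
  ... | no x≢v   = inj₂ (stop x≢v)
  avoid {x = x} v (step _ a w) with x ≟ v | avoid v w
  ... | yes refl | _       = inj₁ on-head
  ... | no _     | inj₁ o  = inj₁ (on-tail o)
  ... | no x≢v   | inj₂ w′ = inj₂ (step x≢v a w′)

  last-exit : ∀ {P x b} a → WalkIn G P x b → a ≢ b →
              WalkIn G (P ∩ (_≢ a)) x b ⊎ ∃ λ y → Arc G a y × WalkIn G (P ∩ (_≢ a)) y b
  last-exit a (stop p) a≢b = inj₁ (stop (p , ≢-sym a≢b))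
  last-exit {x = x} a (step {y = y} p x→y w) a≢b with last-exit a w a≢b | x ≟ a
  ... | inj₂ exit | _        = inj₂ exit
  ... | inj₁ w′   | yes refl = inj₂ (y , x→y , w′)
  ... | inj₁ w′   | no x≢a   = inj₁ (step (p , x≢a) x→y w′)

  arc-into : ∀ {P x y} → WalkIn G P x y → x ≢ y → ∃ λ z → Arc G z y
  arc-into (stop _) x≢x = ⊥-elim (x≢x refl)
  arc-into (step {x} {y} {z} _ x→y w) _ with y ≟ z
  ... | yes refl = x , x→y
  ... | no y≢z   = arc-into w y≢z

  last-below : ∀ {Q} (u : Fin n) {a b} → WalkIn G Q a b → u ≤ b →
               WalkIn G (u ≤_) a b ⊎
               ∃ λ y → ∃ λ w → WalkIn G Q a y × Arc G y w × y < u × WalkIn G (u ≤_) w b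
  last-below u (stop _) u≤b = inj₁ (stop u≤b)
  last-below u (step {x} {y} q x→y w) u≤b with last-below u w u≤b
  ... | inj₂ (y′ , w′ , pre , a , y′<u , suf) = inj₂ (y′ , w′ , step q x→y pre , a , y′<u , suf)
  ... | inj₁ suf with x <? u
  ...   | yes x<u = inj₂ (x , y , stop q , x→y , x<u , suf)
  ...   | no x≮u  = inj₁ (step (ℕ.≮⇒≥ x≮u) x→y suf)

walkIn? : ∀ {n} (G : Graph n) {P : Pred (Fin n) 0ℓ} → Decidable P → ∀ a b → Dec (WalkIn G P a b)
walkIn? G {P} P? a b =
  map′ (WalkIn-map proj₁) (WalkIn-map (_, ∈⊤)) (within Subset.⊤ (ℕ.<-wellFounded _) a)
  where
    -- A walk from a that must leave a need not return to it, so a is dropped from the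
    -- allowed set p; the recursion is on ∣ p ∣.
    within : ∀ p → Acc ℕ._<_ ∣ p ∣ → ∀ a → Dec (WalkIn G (P ∩ (_∈ p)) a b)
    within p (acc rs) a with P? a ×-dec a ∈? p | a ≟ b
    ... | no a∉ | _        = no (a∉ ∘ source-P)
    ... | yes a∈ | yes refl = yes (stop a∈)
    ... | yes a∈@(_ , a∈p) | no a≢b
        with any? (λ y → T? (G a y) ×-dec within (p - a) (rs (x∈p⇒∣p-x∣<∣p∣ a∈p)) y)
    ...   | yes (y , a→y , w) = yes (step a∈ a→y (WalkIn-map (map₂ (p─q⊆p p ⁅ a ⁆)) w))
    ...   | no ∄ = no λ w → case last-exit a w a≢b of λ
      { (inj₁ w′)            → proj₂ (source-P w′) refl
      ; (inj₂ (y , a→y , w′)) → ∄ (y , a→y , WalkIn-map shrink w′) }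
      where
        shrink : (P ∩ (_∈ p)) ∩ (_≢ a) ⊆ P ∩ (_∈ p - a)
        shrink ((pz , z∈p) , z≢a) = pz , x∈p∧x≢y⇒x∈p-y z∈p z≢a

maximum : ∀ {n} {P : Pred (Fin n) 0ℓ} → Decidable P → ∀ {x} → P x →
          ∃ λ y → P y × (∀ z → P z → z ≤ y)
maximum {P = P} P? = go (>-wellFounded _)
  where
    go : ∀ {x} → Acc _>_ x → P x → ∃ λ y → P y × (∀ z → P z → z ≤ y)
    go {x} (acc rs) px with any? (λ z → P? z ×-dec x <? z)
    ... | yes (z , pz , x<z) = go (rs x<z) pz
    ... | no ∄ = x , px , λ z pz → ℕ.≮⇒≥ λ x<z → ∄ (z , pz , x<z)

module RootedTree {n} {T : PTree n} (R : IsRootedTree T) where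
  open IsRootedTree R

  Anc-trans : ∀ {a b c} → Anc T a b → Anc T b c → Anc T a c
  Anc-trans a⊑b (anc-refl _)         = a⊑b
  Anc-trans a⊑b (anc-step c∈ c≢r b⊑) = anc-step c∈ c≢r (Anc-trans a⊑b b⊑)

  Anc-par : ∀ {a b} → Anc T a b → a ≢ b → Anc T a (par T b)
  Anc-par (anc-refl _)       a≢a = ⊥-elim (a≢a refl)
  Anc-par (anc-step _ _ a⊑p) _   = a⊑p

  par-Anc : ∀ {v} → InT T v → v ≢ root T → Anc T (par T v) v
  par-Anc {v} v∈ v≢r = anc-step v∈ v≢r (anc-refl (par∈ v v∈ v≢r))

  Anc-root : ∀ {a} → Anc T a (root T) → a ≡ root T
  Anc-root (anc-refl _)       = refl
  Anc-root (anc-step _ r≢r _) = ⊥-elim (r≢r refl)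

  par≢ : ∀ {v} → InT T v → v ≢ root T → par T v ≢ v
  par≢ {v} v∈ = go (rooted v v∈)
    where
      go : ∀ {v} → Anc T (root T) v → v ≢ root T → par T v ≢ v
      go (anc-refl _)           r≢r _     = r≢r refl
      go (anc-step {v} _ _ r⊑p) v≢r pv≡v =
        go r⊑p (λ pv≡r → v≢r (trans (sym pv≡v) pv≡r)) (subst (λ x → par T x ≡ x) (sym pv≡v) pv≡v)

  Anc-linear : ∀ {a b y} → Anc T a y → Anc T b y → Anc T a b ⊎ Anc T b a
  Anc-linear (anc-refl _)       b⊑a                = inj₂ b⊑a
  Anc-linear (anc-step y∈ y≢r a⊑p) (anc-refl _)   = inj₁ (anc-step y∈ y≢r a⊑p)
  Anc-linear (anc-step _ _ a⊑p) (anc-step _ _ b⊑p) = Anc-linear a⊑p b⊑p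

  Anc? : ∀ u v → InT T v → Dec (Anc T u v)
  Anc? u v v∈ = go (rooted v v∈)
    where
      go : ∀ {v} → Anc T (root T) v → Dec (Anc T u v)
      go (anc-refl r∈) with u ≟ root T
      ... | yes refl = yes (anc-refl r∈)
      ... | no u≢r   = no (u≢r ∘ Anc-root)
      go {v} (anc-step v∈ v≢r r⊑p) with u ≟ v | go r⊑p
      ... | yes refl | _       = yes (anc-refl v∈)
      ... | no _     | yes u⊑p = yes (anc-step v∈ v≢r u⊑p)
      ... | no u≢v   | no u⋢p  = no λ u⊑v → u⋢p (Anc-par u⊑v u≢v)

  child-toward : ∀ {p y} → Anc T p y → p ≢ y →
                 ∃ λ c → Anc T c y × InT T c × c ≢ root T × par T c ≡ p
  child-toward (anc-refl _) p≢p = ⊥-elim (p≢p refl)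
  child-toward {p} (anc-step {y} y∈ y≢r p⊑py) _ with p ≟ par T y
  ... | yes refl = y , anc-refl y∈ , y∈ , y≢r , refl
  ... | no p≢py with child-toward p⊑py p≢py
  ...   | c , c⊑py , c∈ , c≢r , pc≡p = c , anc-step y∈ y≢r c⊑py , c∈ , c≢r , pc≡p

derived-arc-sibling : ∀ {n} {T : PTree n} {v w v′} → DerivedArc T v w v′ → v ≢ par T w → Siblings T v′ w
derived-arc-sibling (_ , inj₁ (v≡pw , _))    v≢pw = ⊥-elim (v≢pw v≡pw)
derived-arc-sibling (_ , inj₂ (_ , v′~w , _)) _    = v′~w

module _ {n} {G : Graph n} {s : Fin n} where

  dominates-start : ∀ {d} → Dominates G s d s → d ≡ s
  dominates-start d∣s with d∣s (stop tt)
  ... | on-stop = refl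

  avoiding-walk⇒¬dominates : ∀ {v w} → WalkIn G (_≢ v) s w → ¬ Dominates G s v w
  avoiding-walk⇒¬dominates s⇝w v∣w = OnWalk⇒P s⇝w (OnWalk-map⁻ _ s⇝w (v∣w (toWalk s⇝w))) refl

  ¬dominates⇒avoiding-walk : ∀ {v w} → ¬ Dominates G s v w → WalkIn G (_≢ v) s w
  ¬dominates⇒avoiding-walk {v} {w} v∤w with walkIn? G (λ z → ¬? (z ≟ v)) s w
  ... | yes s⇝w = s⇝w
  ... | no ∄    = ⊥-elim (v∤w λ p → case avoid v p of λ { (inj₁ v∈p) → v∈p ; (inj₂ s⇝w) → ⊥-elim (∄ s⇝w) })

  dominates-arc-source : ∀ {a b v} → Arc G a b → Dominates G s v b → v ≢ b → Dominates G s v a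
  dominates-arc-source a→b v∣b v≢b p with OnWalk-snoc⁻ p a→b tt (v∣b (snoc p a→b tt))
  ... | inj₁ v∈p = v∈p
  ... | inj₂ v≡b = ⊥-elim (v≢b v≡b)

  dominates-walk-source : ∀ {Q a b v} → WalkIn G Q a b → (∀ {z} → Q z → z ≢ v) →
                          Dominates G s v b → Dominates G s v a
  dominates-walk-source (stop _)          _    v∣b = v∣b
  dominates-walk-source (step _ x→y y⇝b) Q⇒≢ v∣b =
    dominates-arc-source x→y (dominates-walk-source y⇝b Q⇒≢ v∣b) (≢-sym (Q⇒≢ (source-P y⇝b)))

  dominates-trans : ∀ {c d z} → Dominates G s c d → Dominates G s d z → Dominates G s c z
  dominates-trans c∣d d∣z p with prefix p (d∣z p)
  ... | q , q⊆p = q⊆p (c∣d q)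

module DepthFirst {n} {G : Graph n} {s : Fin n} {F : PTree n} (D : IsDFSTree G s F) where
  open IsDFSTree D
  module TreeF = RootedTree tree
  open TreeF using (Anc-trans)

  s-Anc : ∀ v → Anc F s v
  s-Anc v = subst (λ r → Anc F r v) rootF (IsRootedTree.rooted tree v (spanning v))

  s< : ∀ {u} → u ≢ s → s < u
  s< {u} u≢s = ≤∧≢⇒< (ancLe s u (s-Anc u)) (≢-sym u≢s)

  parF< : ∀ {u} → u ≢ s → par F u < u
  parF< {u} u≢s = ≤∧≢⇒< (ancLe _ u (TreeF.par-Anc (spanning u) u≢r)) (TreeF.par≢ (spanning u) u≢r)
    where
      u≢r : u ≢ root F
      u≢r u≡r = u≢s (trans u≡r rootF)

  Anc-antisym : ∀ {a b} → Anc F a b → Anc F b a → a ≡ b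
  Anc-antisym a⊑b b⊑a = ≤-antisym (ancLe _ _ a⊑b) (ancLe _ _ b⊑a)

  tree-path : ∀ {x w} → Anc F x w → WalkIn G (Anc F x ∩ (λ z → Anc F z w)) x w
  tree-path (anc-refl x∈) = stop (anc-refl x∈ , anc-refl x∈)
  tree-path {x} {w} x⊑w@(anc-step w∈ w≢r x⊑p) =
    snoc (WalkIn-map (map₂ (anc-step w∈ w≢r)) (tree-path x⊑p))
         (treeArcs w λ w≡s → w≢r (trans w≡s (sym rootF)))
         (x⊑w , anc-refl w∈)

  dominates⇒Anc : ∀ {a b} → Dominates G s a b → Anc F a b
  dominates⇒Anc {b = b} a∣b = proj₂ (OnWalk⇒P s⇝b (OnWalk-map⁻ _ s⇝b (a∣b (toWalk s⇝b))))
    where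
      s⇝b : WalkIn G (Anc F s ∩ (λ z → Anc F z b)) s b
      s⇝b = tree-path (s-Anc b)

  dominates-Anc : ∀ {a b x} → Anc F b x → Dominates G s a x → ¬ Anc F b a → Dominates G s a b
  dominates-Anc b⊑x a∣x b⋢a = dominates-walk-source (tree-path b⊑x) (λ { (b⊑z , _) refl → b⋢a b⊑z }) a∣x

  -- Each arc (x,y) has x < y, putting x between u and y in preorder, or y an F-ancestor of x.
  ≥-walk⇒Anc-walk : ∀ {u z} → WalkIn G (u ≤_) z u → WalkIn G (Anc F u) z u
  ≥-walk⇒Anc-walk {u} (stop _) = stop (anc-refl (spanning u))
  ≥-walk⇒Anc-walk {u} (step {x} {y} u≤x x→y y⇝u) = step u⊑x x→y y⇝u′
    where
      y⇝u′ : WalkIn G (Anc F u) y u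
      y⇝u′ = ≥-walk⇒Anc-walk y⇝u
      u⊑y : Anc F u y
      u⊑y = source-P y⇝u′
      u⊑x : Anc F u x
      u⊑x with dfsArcs x y x→y
      ... | inj₁ x<y = interval u x y u⊑y u≤x (ℕ.<⇒≤ x<y)
      ... | inj₂ y⊑x = Anc-trans u⊑y y⊑x

  DescH⇒Anc : ∀ {u x} → DescH G F u x → Anc F u x
  DescH⇒Anc {u} dh-refl                       = anc-refl (spanning u)
  DescH⇒Anc (dh-step ((h⊑x , _ , _) , _) u⊒h) = Anc-trans (DescH⇒Anc u⊒h) h⊑x

  dominates-DescH : ∀ {u x v} → DescH G F u x → Dominates G s v u → ¬ Anc F u v → Dominates G s v x
  dominates-DescH dh-refl v∣u _ = v∣u
  dominates-DescH (dh-step ((_ , _ , x⇝h) , _) u⊒h) v∣u u⋢v =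
    dominates-walk-source x⇝h (λ { h⊑z refl → u⋢v (Anc-trans (DescH⇒Anc u⊒h) h⊑z) })
      (dominates-DescH u⊒h v∣u u⋢v)

  HeadCand? : ∀ w u → Dec (HeadCand G F w u)
  HeadCand? w u = Anc? u w ×-dec (¬? (u ≟ w) ×-dec walkIn? G (λ z → Anc? u z) w u)
    where
      Anc? : ∀ a b → Dec (Anc F a b)
      Anc? a b = TreeF.Anc? a b (spanning b)

  -- Maximality of h(w) gives u ≤ h(w), so h(w) is an F-descendant of u, and the tree path
  -- from h(w) to w followed by the walk lets the recursion continue at h(w) < w.
  walk⇒DescH : ∀ {u w} → Anc F u w → WalkIn G (Anc F u) w u → DescH G F u w
  walk⇒DescH = go (<-wellFounded _)
    where
      go : ∀ {u w} → Acc _<_ w → Anc F u w → WalkIn G (Anc F u) w u → DescH G F u w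
      go {u} {w} (acc rs) u⊑w w⇝u with w ≟ u
      ... | yes refl = dh-refl
      ... | no w≢u with maximum (HeadCand? w) (u⊑w , ≢-sym w≢u , w⇝u)
      ...   | h , h-cand@(h⊑w , h≢w , _) , h-max = dh-step (h-cand , h-max) (go (rs h<w) u⊑h (h⇝w ++ʷ w⇝u))
        where
          u⊑h : Anc F u h
          u⊑h = interval u h w u⊑w (h-max u (u⊑w , ≢-sym w≢u , w⇝u)) (ancLe h w h⊑w)
          h<w : h < w
          h<w = ≤∧≢⇒< (ancLe h w h⊑w) h≢w
          h⇝w : WalkIn G (Anc F u) h w
          h⇝w = WalkIn-map (Anc-trans u⊑h ∘ proj₁) (tree-path h⊑w)

module ParentPropertyTree {n} {G : Graph n} {s : Fin n} (FG : IsFlowGraph G s)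
                          {F : PTree n} (D : IsDFSTree G s F)
                          {T : PTree n} (R : IsRootedTree T) (PP : ParentProperty G T) where
  open IsFlowGraph FG
  open IsDFSTree D
  open DepthFirst D
  module TreeT = RootedTree R

  par-Anc-source : ∀ {x y} → Arc G x y → Anc T (par T y) x
  par-Anc-source {x} {y} x→y = proj₂ (proj₂ (PP x y x→y))

  root≡s : root T ≡ s
  root≡s with root T ≟ s
  ... | yes r≡s = r≡s
  ... | no r≢s with arc-into (reachable (root T)) (≢-sym r≢s)
  ...   | x , x→r = ⊥-elim (proj₁ (proj₂ (PP x _ x→r)) refl)

  ≢s⇒≢root : ∀ {v} → v ≢ s → v ≢ root T
  ≢s⇒≢root v≢s v≡r = v≢s (trans v≡r root≡s)

  InT-all : ∀ v → InT T v
  InT-all v with v ≟ s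
  ... | yes refl = subst (InT T) root≡s (IsRootedTree.root∈ R)
  ... | no v≢s with arc-into (reachable v) (≢-sym v≢s)
  ...   | x , x→v = proj₁ (PP x v x→v)

  arc-target≢s : ∀ {x y} → Arc G x y → y ≢ s
  arc-target≢s {x} x→y refl = noEntry x x→y

  parT-Anc : ∀ {v} → v ≢ s → Anc T (par T v) v
  parT-Anc {v} v≢s = TreeT.par-Anc (InT-all v) (≢s⇒≢root v≢s)

  Anc-walk-source : ∀ {Q a b c} → WalkIn G Q a b → (∀ {z} → Q z → z ≢ c) → Anc T c b → Anc T c a
  Anc-walk-source (stop _)          _    c⊑b = c⊑b
  Anc-walk-source (step _ x→y y⇝b) Q⇒≢ c⊑b =
    TreeT.Anc-trans (TreeT.Anc-par (Anc-walk-source y⇝b Q⇒≢ c⊑b) (≢-sym (Q⇒≢ (source-P y⇝b))))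
                    (par-Anc-source x→y)

  Anc⇒dominates : ∀ {a b} → Anc T a b → Dominates G s a b
  Anc⇒dominates {a} a⊑b p with avoid a p
  ... | inj₁ a∈p  = a∈p
  ... | inj₂ s⇝b = ⊥-elim (source-P s⇝b (sym a≡s))
    where
      a≡s : a ≡ s
      a≡s = trans (TreeT.Anc-root (subst (Anc T a) (sym root≡s) (Anc-walk-source s⇝b (λ z≢a → z≢a) a⊑b))) root≡s

  Anc⇒≤ : ∀ {a b} → Anc T a b → a ≤ b
  Anc⇒≤ = ancLe _ _ ∘ dominates⇒Anc ∘ Anc⇒dominates

  Anc-antisymᵀ : ∀ {a b} → Anc T a b → Anc T b a → a ≡ b
  Anc-antisymᵀ a⊑b b⊑a = ≤-antisym (Anc⇒≤ a⊑b) (Anc⇒≤ b⊑a)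

  parT< : ∀ {v} → v ≢ s → par T v < v
  parT< {v} v≢s = ≤∧≢⇒< (Anc⇒≤ (parT-Anc v≢s)) (TreeT.par≢ (InT-all v) (≢s⇒≢root v≢s))

  ¬Anc-parT : ∀ {v} → v ≢ s → ¬ Anc T v (par T v)
  ¬Anc-parT v≢s v⊑pv = ℕ.<⇒≱ (parT< v≢s) (Anc⇒≤ v⊑pv)

  ¬Anc-parF : ∀ {v} → v ≢ s → ¬ Anc T v (par F v)
  ¬Anc-parF v≢s v⊑pv = ℕ.<⇒≱ (parF< v≢s) (Anc⇒≤ v⊑pv)

  siblings-unique : ∀ {a b y} → Anc T a y → Anc T b y → a ≢ s → b ≢ s → par T a ≡ par T b → a ≡ b
  siblings-unique {a} {b} a⊑y b⊑y a≢s b≢s pa≡pb with a ≟ b | TreeT.Anc-linear a⊑y b⊑y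
  ... | yes a≡b | _         = a≡b
  ... | no a≢b  | inj₁ a⊑b = ⊥-elim (¬Anc-parT a≢s (subst (Anc T a) (sym pa≡pb) (TreeT.Anc-par a⊑b a≢b)))
  ... | no a≢b  | inj₂ b⊑a = ⊥-elim (¬Anc-parT b≢s (subst (Anc T b) pa≡pb (TreeT.Anc-par b⊑a (≢-sym a≢b))))

  derived-arc : ∀ {y w} → Arc G y w → ¬ Anc T w y → ∃ λ y′ → DerivedArc T y w y′ × Anc T y′ y
  derived-arc {y} {w} y→w w⋢y with y ≟ par T w
  ... | yes y≡pw = y , (w⋢y , inj₁ (y≡pw , refl)) , anc-refl (InT-all y)
  ... | no y≢pw with TreeT.child-toward (par-Anc-source y→w) (≢-sym y≢pw)
  ...   | c , c⊑y , c∈ , c≢r , pc≡pw =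
    c , (w⋢y , inj₂ (y≢pw , (c≢w , c∈ , InT-all w , c≢r , ≢s⇒≢root (arc-target≢s y→w) , pc≡pw) , c⊑y)) , c⊑y
    where
      c≢w : c ≢ w
      c≢w refl = w⋢y c⊑y

  Anc-DescH : ∀ {u x c} → DescH G F u x → Anc T c u → ¬ Anc F u c → Anc T c x
  Anc-DescH dh-refl c⊑u _ = c⊑u
  Anc-DescH (dh-step ((_ , _ , x⇝h) , _) u⊒h) c⊑u u⋢c =
    Anc-walk-source x⇝h (λ { h⊑z refl → u⋢c (TreeF.Anc-trans (DescH⇒Anc u⊒h) h⊑z) })
      (Anc-DescH u⊒h c⊑u u⋢c)

  Anc-of-F-descendant : ∀ {u x c} → Anc F u x → Anc T c x → Anc T c u ⊎ Anc F u c
  Anc-of-F-descendant (anc-refl _) c⊑u = inj₁ c⊑u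
  Anc-of-F-descendant {c = c} u⊑x@(anc-step {x} _ x≢r u⊑p) c⊑x with c ≟ x
  ... | yes refl = inj₂ u⊑x
  ... | no c≢x   = Anc-of-F-descendant u⊑p
    (TreeT.Anc-trans (TreeT.Anc-par c⊑x c≢x) (par-Anc-source (treeArcs x λ x≡s → x≢r (trans x≡s (sym rootF)))))

  ≢root⇒≢s : ∀ {v} → v ≢ root T → v ≢ s
  ≢root⇒≢s v≢r v≡s = v≢r (trans v≡s (sym root≡s))

  sibling-dominator : ∀ {d z} → z ≢ s → Anc T (par T z) d → par T z ≢ d → d < z → Dominates G s d z →
                      ∃ λ c → Siblings T c z × Dominates G s c z
  sibling-dominator {d} {z} z≢s p⊑d p≢d d<z d∣z with TreeT.child-toward p⊑d p≢d
  ... | c , c⊑d , c∈ , c≢r , pc≡p =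
    c , (c≢z , c∈ , InT-all z , c≢r , ≢s⇒≢root z≢s , pc≡p) , dominates-trans (Anc⇒dominates c⊑d) d∣z
    where
      c≢z : c ≢ z
      c≢z = <⇒≢ (ℕ.≤-<-trans (Anc⇒≤ c⊑d) d<z)

  SeparatingEntry : Fin n → Fin n → Set
  SeparatingEntry u c = ∃ λ y → ∃ λ w → ∃ λ y′ →
    Arc G y w × DerivedArc T y w y′ × DescH G F u w × y < u × y′ ≢ c

  DerivedArcCondition : Fin n → Set
  DerivedArcCondition u =
    par F u ≡ par T u ⊎ Σ (Fin n) λ f′ → DerivedArc T (par F u) u f′ × SeparatingEntry u f′

  ¬Anc-from-below : ∀ {u w y} → Anc F u w → y < u → ¬ Anc T w y
  ¬Anc-from-below u⊑w y<u w⊑y = ℕ.<⇒≱ y<u (ℕ.≤-trans (ancLe _ _ u⊑w) (Anc⇒≤ w⊑y))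

  -- A walk from s avoiding c enters the H-subtree of u along its last arc from below u.
  separating-entry : ∀ {u c} → u ≢ s → ¬ Dominates G s c u → SeparatingEntry u c
  separating-entry {u} {c} u≢s c∤u with last-below u (¬dominates⇒avoiding-walk c∤u) ≤-refl
  ... | inj₁ s⇝u = ⊥-elim (ℕ.<⇒≱ (s< u≢s) (source-P s⇝u))
  ... | inj₂ (y , w , s⇝y , y→w , y<u , w⇝u)
      with derived-arc y→w (¬Anc-from-below (source-P (≥-walk⇒Anc-walk w⇝u)) y<u)
  ...   | y′ , derived , y′⊑y =
    y , w , y′ , y→w , derived , walk⇒DescH (source-P w⇝u′) w⇝u′ , y<u ,
    λ { refl → avoiding-walk⇒¬dominates s⇝y (Anc⇒dominates y′⊑y) }
    where
      w⇝u′ : WalkIn G (Anc F u) w u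
      w⇝u′ = ≥-walk⇒Anc-walk w⇝u

  forward : SiblingProperty G s T → ∀ u → u ≢ s → DerivedArcCondition u
  forward sp u u≢s with par F u ≟ par T u
  ... | yes pF≡pT = inj₁ pF≡pT
  ... | no pF≢pT with derived-arc (treeArcs u u≢s) (¬Anc-parF u≢s)
  ...   | f′ , derived , _ =
    inj₂ (f′ , derived , separating-entry u≢s (sp f′ u (derived-arc-sibling derived pF≢pT)))

  SiblingPropertyBelow : Fin n → Set
  SiblingPropertyBelow u = ∀ {v b} → b < u → Siblings T v b → ¬ Dominates G s v b

  module _ {u} (sp< : SiblingPropertyBelow u) where

    dominator⇒Anc : ∀ {d z} → z < u → Dominates G s d z → Anc T d z
    dominator⇒Anc = go (<-wellFounded _)
      where
        go : ∀ {d z} → Acc _<_ z → z < u → Dominates G s d z → Anc T d z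
        go {d} {z} (acc rs) z<u d∣z with d ≟ z | z ≟ s
        ... | yes refl | _        = anc-refl (InT-all d)
        ... | no d≢z   | yes refl = ⊥-elim (d≢z (dominates-start d∣z))
        ... | no d≢z   | no z≢s with <-cmp d (par T z)
        ...   | tri≈ _ refl _ = parT-Anc z≢s
        ...   | tri< d<p _ _  = TreeT.Anc-trans (go (rs p<z) (<-trans p<z z<u) d∣p) (parT-Anc z≢s)
          where
            p<z : par T z < z
            p<z = parT< z≢s
            d∣p : Dominates G s d (par T z)
            d∣p = dominates-Anc (dominates⇒Anc (Anc⇒dominates (parT-Anc z≢s))) d∣z
                    (λ p⊑d → ℕ.<⇒≱ d<p (ancLe _ _ p⊑d))
        ...   | tri> _ _ p<d  =
          ⊥-elim (case sibling-dominator z≢s p⊑d (<⇒≢ p<d) d<z d∣z of λ (_ , c~z , c∣z) → sp< z<u c~z c∣z)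
          where
            d⊑z : Anc F d z
            d⊑z = dominates⇒Anc d∣z
            d<z : d < z
            d<z = ≤∧≢⇒< (ancLe _ _ d⊑z) d≢z
            p∣d : Dominates G s (par T z) d
            p∣d = dominates-Anc d⊑z (Anc⇒dominates (parT-Anc z≢s)) (λ d⊑p → ℕ.<⇒≱ p<d (ancLe _ _ d⊑p))
            p⊑d : Anc T (par T z) d
            p⊑d = go (rs d<z) (<-trans d<z z<u) p∣d

    module _ {v} (v≢u : v ≢ u) (v≢s : v ≢ s) (pv≡pu : par T v ≡ par T u) (v∣u : Dominates G s v u) where

      private
        u≢s : u ≢ s
        u≢s refl = v≢s (dominates-start v∣u)

        u⋢v : ¬ Anc F u v
        u⋢v u⊑v = v≢u (Anc-antisym (dominates⇒Anc v∣u) u⊑v)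

        u⋢pu : ¬ Anc F u (par T u)
        u⋢pu u⊑pu = ℕ.<⇒≱ (parT< u≢s) (ancLe _ _ u⊑pu)

        v⋢DescH : ∀ {x} → DescH G F u x → ¬ Anc T v x
        v⋢DescH u⊒x v⊑x with Anc-of-F-descendant (DescH⇒Anc u⊒x) v⊑x
        ... | inj₁ v⊑u = ¬Anc-parT v≢s (subst (Anc T v) (sym pv≡pu) (TreeT.Anc-par v⊑u v≢u))
        ... | inj₂ u⊑v = u⋢v u⊑v

        v⋢par-entry : ∀ {x y} → DescH G F u x → Arc G y x → ¬ Anc T v (par T x)
        v⋢par-entry u⊒x y→x v⊑px = v⋢DescH u⊒x (TreeT.Anc-trans v⊑px (parT-Anc (arc-target≢s y→x)))

        v⊑entry : ∀ {x y} → DescH G F u x → Arc G y x → y < u → Anc T v y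
        v⊑entry {x} u⊒x y→x y<u = dominator⇒Anc y<u (dominates-arc-source y→x (dominates-DescH u⊒x v∣u u⋢v) v≢x)
          where
            v≢x : v ≢ x
            v≢x refl = u⋢v (DescH⇒Anc u⊒x)

        par-entry≡ : ∀ {x y} → DescH G F u x → Arc G y x → Anc T v y → par T x ≡ par T u
        par-entry≡ {x} u⊒x y→x v⊑y with TreeT.Anc-linear v⊑y (par-Anc-source y→x) | par T x ≟ v
        ... | inj₁ v⊑px | _        = ⊥-elim (v⋢par-entry u⊒x y→x v⊑px)
        ... | inj₂ _    | yes refl = ⊥-elim (v⋢par-entry u⊒x y→x (anc-refl (InT-all v)))
        ... | inj₂ px⊑v | no px≢v  =
          Anc-antisymᵀ (subst (Anc T (par T x)) pv≡pu (TreeT.Anc-par px⊑v px≢v))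
                       (TreeT.Anc-par (Anc-DescH u⊒x (parT-Anc u≢s) u⋢pu) pu≢x)
          where
            pu≢x : par T u ≢ x
            pu≢x refl = u⋢pu (DescH⇒Anc u⊒x)

      derived-source≡ : ∀ {x y y′} → DescH G F u x → Arc G y x → y < u → DerivedArc T y x y′ → y′ ≡ v
      derived-source≡ u⊒x y→x y<u (_ , inj₁ (y≡px , _)) =
        ⊥-elim (v⋢par-entry u⊒x y→x (subst (Anc T v) y≡px (v⊑entry u⊒x y→x y<u)))
      derived-source≡ {y = y} u⊒x y→x y<u (_ , inj₂ (_ , (_ , _ , _ , y′≢r , _ , py′≡px) , y′⊑y)) =
        siblings-unique y′⊑y v⊑y (≢root⇒≢s y′≢r) v≢s (trans py′≡px (trans (par-entry≡ u⊒x y→x v⊑y) (sym pv≡pu)))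
        where
          v⊑y : Anc T v y
          v⊑y = v⊑entry u⊒x y→x y<u

    -- The tree arc (f(u),u) is itself an arc entering the H-subtree of u from below.
    no-sibling-dominates : DerivedArcCondition u → ∀ {v} → Siblings T v u → ¬ Dominates G s v u
    no-sibling-dominates (inj₁ pF≡pT) {v} (v≢u , v∈ , _ , v≢r , u≢r , pv≡pu) v∣u =
      TreeT.par≢ v∈ v≢r (trans pv≡pu (trans (sym pF≡pT) pF≡v))
      where
        u≢s : u ≢ s
        u≢s = ≢root⇒≢s u≢r
        pF≡v : par F u ≡ v
        pF≡v = derived-source≡ v≢u (≢root⇒≢s v≢r) pv≡pu v∣u dh-refl (treeArcs u u≢s) (parF< u≢s)
                 (¬Anc-parF u≢s , inj₁ (pF≡pT , refl))
    no-sibling-dominates (inj₂ (f′ , f-derived , y , x , y′ , y→x , y-derived , u⊒x , y<u , y′≢f′))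
                         {v} (v≢u , _ , _ , v≢r , u≢r , pv≡pu) v∣u =
      y′≢f′ (trans (source≡v u⊒x y→x y<u y-derived) (sym (source≡v dh-refl (treeArcs u u≢s) (parF< u≢s) f-derived)))
      where
        u≢s : u ≢ s
        u≢s = ≢root⇒≢s u≢r
        source≡v : ∀ {x y y′} → DescH G F u x → Arc G y x → y < u → DerivedArc T y x y′ → y′ ≡ v
        source≡v = derived-source≡ v≢u (≢root⇒≢s v≢r) pv≡pu v∣u

  backward : (∀ u → u ≢ s → DerivedArcCondition u) → SiblingProperty G s T
  backward cond v u = go (<-wellFounded u)
    where
      go : ∀ {u v} → Acc _<_ u → Siblings T v u → ¬ Dominates G s v u
      go {u} (acc rs) v~u@(_ , _ , _ , _ , u≢r , _) =
        no-sibling-dominates (λ b<u → go (rs b<u)) (cond u (≢root⇒≢s u≢r)) v~u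

lemma25 : ∀ {n} (G : Graph n) (s : Fin n) → IsFlowGraph G s →
          (F : PTree n) → IsDFSTree G s F →
          (T : PTree n) → IsRootedTree T → ParentProperty G T →
          SiblingProperty G s T ⇔
            (∀ u → u ≢ s →
              par F u ≡ par T u ⊎
              Σ (Fin n) (λ fu' → DerivedArc T (par F u) u fu' ×
                ∃ (λ y → ∃ (λ w → ∃ (λ y' →
                  Arc G y w × DerivedArc T y w y' × DescH G F u w ×
                  y < u × y' ≢ fu')))))
lemma25 G s FG F D T R PP = mk⇔ forward backward
  where open ParentPropertyTree FG D R PP
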